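{- Let $\epsilon\ge0$, let $n_s,n_t$ be nodes, and let $\rho$ be a route from $n_s$ to a node $n_x$. Let $\mathit{snfC}^+$ be an upper bound on the complexity of a simplest near-fastest route from $n_s$ to $n_t$. If $C(\rho)+\mathit{fsC}[n_x] > \mathit{snfC}^+$, then no route from $n_s$ to $n_t$ having $\rho$ as its initial segment is a simplest near-fastest route from $n_s$ to $n_t$.
   Context: Let $V$ be a finite set of nodes. A road is a finite sequence of distinct nodes of $V$. Let $R$ be a finite set of roads such that every node lies on at least one road and any pair of consecutive nodes of some road does not appear (as consecutive nodes) in any other road. For $n\in V$, $R(n)$ is the set of roads containing $n$. The road network is the directed graph $G_R=(V,E)$ with an edge $(n_i,n_j)$ whenever $n_i,n_j$ are consecutive nodes of some road; $R(n_i,n_j)$ denotes the unique road containing this segment. A length function $L:E\to\mathbb{R}^+$ is given; the turn cost is $C(n,r,r')=1$ if $r\neq r'$ and $0$ if $r=r'$. A route is a node sequence $(n_1,\dots,n_k)$ with consecutive nodes joined by edges; its length $L(\cdot)$ is the sum of its edge lengths and its complexity is $C(\cdot)=\sum_{m=2}^{k-1}C(n_m,R(n_{m-1},n_m),R(n_m,n_{m+1}))$. A route from $n_s$ to $n_t$ is near-fastest if its length is at most $(1+\epsilon)$ times the minimum length of a route from $n_s$ to $n_t$; a simplest near-fastest route has minimum complexity among all near-fastest routes from $n_s$ to $n_t$. A simplest route from $a$ to $b$ has minimum complexity among routes from $a$ to $b$, and a fastest simplest route has minimum length among simplest routes. For each node $n$, $\mathit{fsC}[n]$ denotes the complexity of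 a fastest simplest route from $n$ to $n_t$, i.e., the minimum complexity of a route from $n$ to $n_t$.
   Formalization: The length function L and the parameter ε take rational values rather than real ones. -}

module Defs where

open import Data.Nat using (ℕ; zero; suc; _+_; _≤_)
open import Data.Fin using (Fin)
open import Data.Fin.Properties using (_≟_)
open import Data.List using (List; []; _∷_)
open import Data.List.Membership.Propositional using (_∈_)
open import Data.List.Relation.Unary.Unique.Propositional using (Unique)
open import Data.Product using (Σ; ∃; _×_; _,_; proj₁)
open import Data.Rational using (ℚ; 0ℚ; 1ℚ) renaming (_+_ to _+ℚ_; _*_ to _*ℚ_; _≤_ to _≤ℚ_)
open import Relation.Binary.PropositionalEquality using (_≡_)
open import Relation.Nullary using (yes; no)

data Consec {A : Set} (a b : A) : List A → Set where
  here  : ∀ {xs} → Consec a b (a ∷ b ∷ xs)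
  there : ∀ {x xs} → Consec a b xs → Consec a b (x ∷ xs)

record RoadNetwork : Set where
  field
    nV nR      : ℕ
    road       : Fin nR → List (Fin nV)
    roadUnique : ∀ i → Unique (road i)
    -- R is a set of roads (no road listed twice)
    roadInj    : ∀ i j → road i ≡ road j → i ≡ j
    covers     : ∀ (n : Fin nV) → ∃ λ i → n ∈ road i
    segUnique  : ∀ i j (a b : Fin nV) → Consec a b (road i) → Consec a b (road j) → i ≡ j

open RoadNetwork public

Node : RoadNetwork → Set
Node N = Fin (nV N)

-- An edge (a , b) of G_R, together with the (unique) road R(a,b) containing it.
Edge : (N : RoadNetwork) → Node N → Node N → Set
Edge N a b = Σ (Fin (nR N)) λ i → Consec a b (road N i)

roadOf : ∀ {N a b} → Edge N a b → Fin (nR N)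
roadOf = proj₁

data Route (N : RoadNetwork) : Node N → Node N → Set where
  [_] : (a : Node N) → Route N a a
  _∷_ : ∀ {a b c} → Edge N a b → Route N b c → Route N a c

infixr 5 _∷_ _++_

_++_ : ∀ {N a b c} → Route N a b → Route N b c → Route N a c
[ _ ]   ++ τ = τ
(e ∷ ρ) ++ τ = e ∷ (ρ ++ τ)

turn : ∀ {n} → Fin n → Fin n → ℕ
turn i j with i ≟ j
... | yes _ = 0
... | no  _ = 1

C : ∀ {N a b} → Route N a b → ℕ
C [ _ ]                      = 0
C (e ∷ [ _ ])                = 0
C {N} (e ∷ (e' ∷ ρ))         = turn {nR N} (proj₁ e) (proj₁ e') + C (e' ∷ ρ)

Len : ∀ {N a b} → (Node N → Node N → ℚ) → Route N a b → ℚ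
Len L [ _ ]                  = 0ℚ
Len L (_∷_ {a} {b} e ρ)      = L a b +ℚ Len L ρ

NearFastest : (N : RoadNetwork) → (Node N → Node N → ℚ) → ℚ →
              (ns nt : Node N) → Route N ns nt → Set
NearFastest N L ε ns nt π = ∀ (σ : Route N ns nt) → Len L π ≤ℚ ((1ℚ +ℚ ε) *ℚ Len L σ)

SimplestNearFastest : (N : RoadNetwork) → (Node N → Node N → ℚ) → ℚ →
                      (ns nt : Node N) → Route N ns nt → Set
SimplestNearFastest N L ε ns nt π =
  NearFastest N L ε ns nt π ×
  (∀ (σ : Route N ns nt) → NearFastest N L ε ns nt σ → C π ≤ C σ)

-- f = fsC[n]: the minimum complexity of a route from n to nt
-- (= complexity of a fastest simplest route from n to nt)
IsFsC : (N : RoadNetwork) → (n nt : Node N) → ℕ → Set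
IsFsC N n nt f = (Σ (Route N n nt) λ ρ → C ρ ≡ f) × (∀ (ρ : Route N n nt) → f ≤ C ρ)

{-# OPTIONS --safe #-}
module Submission where

open import Defs
open import Data.Nat using (ℕ; _+_; _≤_; _<_; z≤n)
open import Data.Nat.Properties using (≤-refl; m≤n+m; +-assoc; +-monoʳ-≤; <-irrefl; module ≤-Reasoning)
open import Data.Rational using (ℚ; 0ℚ) renaming (_<_ to _<ℚ_; _≤_ to _≤ℚ_)
open import Relation.Nullary using (¬_)
open import Relation.Binary.PropositionalEquality using (refl)
open import Data.Product using (proj₁; proj₂)

C≤C-∷ : ∀ {N a b c} (e : Edge N a b) (τ : Route N b c) → C τ ≤ C (e ∷ τ)
C≤C-∷ e [ _ ]         = z≤n
C≤C-∷ {N} e (e' ∷ τ) = m≤n+m (C (e' ∷ τ)) (turn {nR N} (proj₁ e) (proj₁ e'))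

-- The turn at the junction node of ρ ++ τ is counted on the right but not on the left.
C+C≤C-++ : ∀ {N a b c} (ρ : Route N a b) (τ : Route N b c) → C ρ + C τ ≤ C (ρ ++ τ)
C+C≤C-++ [ _ ]            τ = ≤-refl
C+C≤C-++ (e ∷ [ _ ])      τ = C≤C-∷ e τ
C+C≤C-++ {N} (e ∷ e' ∷ ρ) τ = begin
  t + C (e' ∷ ρ) + C τ       ≡⟨ +-assoc t (C (e' ∷ ρ)) (C τ) ⟩
  t + (C (e' ∷ ρ) + C τ)     ≤⟨ +-monoʳ-≤ t (C+C≤C-++ (e' ∷ ρ) τ) ⟩
  t + C ((e' ∷ ρ) ++ τ)      ∎
  where
  open ≤-Reasoning
  t : ℕ
  t = turn {nR N} (proj₁ e) (proj₁ e')

C+fsC≤C-++ : ∀ {N ns nx nt} (ρ : Route N ns nx) (τ : Route N nx nt) {fsCx : ℕ} →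
             IsFsC N nx nt fsCx → C ρ + fsCx ≤ C (ρ ++ τ)
C+fsC≤C-++ ρ τ {fsCx} fs = begin
  C ρ + fsCx     ≤⟨ +-monoʳ-≤ (C ρ) (proj₂ fs τ) ⟩
  C ρ + C τ      ≤⟨ C+C≤C-++ ρ τ ⟩
  C (ρ ++ τ)     ∎
  where open ≤-Reasoning

lemma5 : (N : RoadNetwork) (L : Node N → Node N → ℚ) →
    (∀ a b → Edge N a b → 0ℚ <ℚ L a b) →
    (ε : ℚ) → 0ℚ ≤ℚ ε →
    (ns nt nx : Node N) (ρ : Route N ns nx) →
    (snfC⁺ fsCx : ℕ) →
    IsFsC N nx nt fsCx →
    (∀ (π : Route N ns nt) → SimplestNearFastest N L ε ns nt π → C π ≤ snfC⁺) →
    snfC⁺ < C ρ + fsCx →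
    ∀ (τ : Route N nx nt) → ¬ SimplestNearFastest N L ε ns nt (ρ ++ τ)
lemma5 N L _ ε _ ns nt nx ρ snfC⁺ fsCx fs snfC⁺-bound snfC⁺<C+fsC τ snf =
  <-irrefl refl (begin-strict
    snfC⁺          <⟨ snfC⁺<C+fsC ⟩
    C ρ + fsCx     ≤⟨ C+fsC≤C-++ ρ τ fs ⟩
    C (ρ ++ τ)     ≤⟨ snfC⁺-bound (ρ ++ τ) snf ⟩
    snfC⁺          ∎)
  where open ≤-Reasoning
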